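{- Let $g(x)=1+g_1x+g_2x^2+\cdots\in\mathbb{Z}[[x]]$ and let $\mathbf{C}(g(x))$ denote its central transform (defined in the context). Then $$\mathbf{C}(g(x))=\frac{1}{\sqrt{1-4x}\;g\!\left(xc(x)^2\right)},$$ where $c(x)=\frac{1-\sqrt{1-4x}}{2x}$ is the generating function of the Catalan numbers.
   Context: For a power series $g(x)\in\mathbb{Z}[[x]]$ with $g(0)=1$, consider the lower-triangular matrix $(t_{n,k})_{n,k\ge0}$ with $t_{n,k}=[x^n]\,\frac{1}{1-x}\,\frac{1}{g\left(\frac{x}{1-x}\right)}\left(\frac{x}{1-x}\right)^k$ (here $[x^n]$ extracts the coefficient of $x^n$). The central transform $\mathbf{C}(g(x))$ is the power series $\sum_{n\ge0} b_nx^n$ with $b_n=t_{2n,n}$ (the central elements of this matrix). Equivalently, this matrix is the product of the binomial matrix $\left(\binom{n}{k}\right)$ with the inverse of the lower-triangular Toeplitz matrix whose columns are the coefficients of $g$, and $\mathbf{C}(g)$ lists its $(2n,n)$ entries. $c(x)=\frac{1-\sqrt{1-4x}}{2x}$. -}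

module Defs where

open import Data.Nat using (ℕ; zero; suc; _∸_; _+_)
open import Data.Integer using (ℤ; +_; -_) renaming (_+_ to _+ℤ_; _*_ to _*ℤ_)
open import Data.Fin using (Fin; toℕ; opposite)
open import Data.Vec using (Vec; []; _∷_; head; lookup)

-- Formal power series over ℤ, represented by their coefficient sequences.
Series : Set
Series = ℕ → ℤ

sumTo : ℕ → (ℕ → ℤ) → ℤ
sumTo zero    f = f 0
sumTo (suc n) f = sumTo n f +ℤ f (suc n)

sumFin : ∀ {n} → (Fin n → ℤ) → ℤ
sumFin {zero}  f = + 0
sumFin {suc n} f = f Fin.zero +ℤ sumFin (λ i → f (Fin.suc i))

_⊛_ : Series → Series → Series
(f ⊛ g) n = sumTo n (λ k → f k *ℤ g (n ∸ k))

one : Series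
one zero    = + 1
one (suc _) = + 0

X : Series
X 1 = + 1
X _ = + 0

pow : Series → ℕ → Series
pow h zero    = one
pow h (suc j) = h ⊛ pow h j

-- Composition f(h(x)); meaningful when h 0 = 0 (then [x^n] h^j = 0 for j > n).
comp : Series → Series → Series
comp f h n = sumTo n (λ j → f j *ℤ pow h j n)

-- Multiplicative inverse of a series a with a 0 = 1:
-- b 0 = 1, b n = - Σ_{k=1}^{n} a k * b (n - k).
-- invPrefix a n = [b n, b (n-1), ..., b 0].
invPrefix : Series → (n : ℕ) → Vec ℤ (suc n)
invPrefix a zero    = + 1 ∷ []
invPrefix a (suc n) =
  let v = invPrefix a n in
  (- sumFin (λ (i : Fin (suc n)) → a (suc (toℕ i)) *ℤ lookup v i)) ∷ v

inv : Series → Series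
inv a n = head (invPrefix a n)

-- Catalan numbers: C 0 = 1, C (n+1) = Σ_{k=0}^{n} C k C (n-k);
-- catPrefix n = [C n, ..., C 0].
catPrefix : (n : ℕ) → Vec ℤ (suc n)
catPrefix zero    = + 1 ∷ []
catPrefix (suc n) =
  let v = catPrefix n in
  sumFin (λ (i : Fin (suc n)) → lookup v i *ℤ lookup v (opposite i)) ∷ v

catalanGF : Series
catalanGF n = head (catPrefix n)

geom : Series
geom _ = + 1

xOver1mx : Series
xOver1mx zero    = + 0
xOver1mx (suc _) = + 1

oneMinus4x : Series
oneMinus4x zero          = + 1
oneMinus4x (suc zero)    = - (+ 4)
oneMinus4x (suc (suc _)) = + 0

riordanEntry : Series → ℕ → ℕ → ℤ
riordanEntry g n k = (geom ⊛ (inv (comp g xOver1mx) ⊛ pow xOver1mx k)) n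

centralTransform : Series → Series
centralTransform g n = riordanEntry g (n + n) n

-- With h = 1/g, both sides equal Σⱼ hⱼ C(2n, n + j).
--
-- Left: t_{N,k} = [x^N] h(x/(1−x)) (x/(1−x))^k/(1−x), and [x^N] (x/(1−x))^i/(1−x) = C(N, i) by the
-- hockey-stick identity; the terms with j > n vanish.
--
-- Right: a square root of 1 − 4x with constant term 1 is unique, hence equals 1 − 2x c(x), so the
-- right-hand side is h(x c²)/√(1 − 4x). The series (x c²)ᵐ/√(1 − 4x) satisfy, through
-- x c² = x (1 + x c²)², the recurrence a_{m+1,n+1} = a_{m,n} + 2a_{m+1,n} + a_{m+2,n} of the
-- binomial coefficients C(2n, m + n).
--
-- Composition f(h) = Σⱼ fⱼ hʲ is treated as a locally finite linear combination; the same
-- exchange of summation makes the Cauchy product associative and composition multiplicative.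

module Submission where

open import Data.Nat using (ℕ; zero; suc; _∸_; _+_; _≤_; _<_; z≤n; s≤s)
import Data.Nat.Properties as ℕP
open import Data.Nat.Combinatorics using (_C_; k>n⇒nCk≡0; nCk+nC[k+1]≡[n+1]C[k+1]; nCk≡nC[n∸k])
open import Data.Integer using (ℤ; 0ℤ; +_; -_; _≟_) renaming (_+_ to _+ℤ_; _*_ to _*ℤ_)
import Data.Integer as ℤ
import Data.Integer.Properties as ℤP
open import Data.Integer.Tactic.RingSolver using (solve-∀)
open import Data.Fin using (Fin; toℕ; opposite)
open import Data.Fin.Properties using (opposite-prop)
open import Data.Vec using (lookup)
open import Data.Maybe using (Maybe; just; nothing)
open import Data.Product using (_,_)
open import Data.Sum using (inj₁; inj₂)
open import Relation.Nullary using (yes; no)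
open import Relation.Binary.PropositionalEquality
open import Algebra.Bundles using (CommutativeRing)
import Algebra.Solver.Ring.AlmostCommutativeRing as ACR
import Algebra.Solver.Ring as RingSolver
import Algebra.Construct.Pointwise ℕ as Pointwise
import Algebra.Properties.CommutativeSemigroup as CommSemigroupProperties

open import Defs

open ≡-Reasoning

sumTo-cong : ∀ n {f g : ℕ → ℤ} → (∀ k → f k ≡ g k) → sumTo n f ≡ sumTo n g
sumTo-cong zero    f≗g = f≗g 0
sumTo-cong (suc n) f≗g = cong₂ _+ℤ_ (sumTo-cong n f≗g) (f≗g (suc n))

sumTo-cong-≤ : ∀ n {f g : ℕ → ℤ} → (∀ k → k ≤ n → f k ≡ g k) → sumTo n f ≡ sumTo n g
sumTo-cong-≤ zero    f≗g = f≗g 0 z≤n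
sumTo-cong-≤ (suc n) f≗g =
  cong₂ _+ℤ_ (sumTo-cong-≤ n (λ k k≤n → f≗g k (ℕP.m≤n⇒m≤1+n k≤n))) (f≗g (suc n) ℕP.≤-refl)

sumTo-sucˡ : ∀ n (f : ℕ → ℤ) → sumTo (suc n) f ≡ f 0 +ℤ sumTo n (λ k → f (suc k))
sumTo-sucˡ zero    f = refl
sumTo-sucˡ (suc n) f = trans (cong (_+ℤ f (suc (suc n))) (sumTo-sucˡ n f))
  (ℤP.+-assoc (f 0) (sumTo n (λ k → f (suc k))) (f (suc (suc n))))

sumTo-0 : ∀ n (f : ℕ → ℤ) → (∀ k → k ≤ n → f k ≡ 0ℤ) → sumTo n f ≡ 0ℤ
sumTo-0 zero    f f≡0 = f≡0 0 z≤n
sumTo-0 (suc n) f f≡0 =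
  cong₂ _+ℤ_ (sumTo-0 n f (λ k k≤n → f≡0 k (ℕP.m≤n⇒m≤1+n k≤n))) (f≡0 (suc n) ℕP.≤-refl)

sumTo-+ : ∀ n (f g : ℕ → ℤ) → sumTo n (λ k → f k +ℤ g k) ≡ sumTo n f +ℤ sumTo n g
sumTo-+ zero    f g = refl
sumTo-+ (suc n) f g = trans (cong (_+ℤ (f (suc n) +ℤ g (suc n))) (sumTo-+ n f g))
  (interchange (sumTo n f) (sumTo n g) (f (suc n)) (g (suc n)))
  where
  interchange : ∀ a b c d → (a +ℤ b) +ℤ (c +ℤ d) ≡ (a +ℤ c) +ℤ (b +ℤ d)
  interchange = solve-∀

sumTo-*ˡ : ∀ n c (f : ℕ → ℤ) → sumTo n (λ k → c *ℤ f k) ≡ c *ℤ sumTo n f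
sumTo-*ˡ zero    c f = refl
sumTo-*ˡ (suc n) c f = trans (cong (_+ℤ c *ℤ f (suc n)) (sumTo-*ˡ n c f))
  (sym (ℤP.*-distribˡ-+ c (sumTo n f) (f (suc n))))

sumTo-*ʳ : ∀ n c (f : ℕ → ℤ) → sumTo n (λ k → f k *ℤ c) ≡ sumTo n f *ℤ c
sumTo-*ʳ zero    c f = refl
sumTo-*ʳ (suc n) c f = trans (cong (_+ℤ f (suc n) *ℤ c) (sumTo-*ʳ n c f))
  (sym (ℤP.*-distribʳ-+ c (sumTo n f) (f (suc n))))

sumTo-reverse : ∀ n (f : ℕ → ℤ) → sumTo n f ≡ sumTo n (λ k → f (n ∸ k))
sumTo-reverse zero    f = refl
sumTo-reverse (suc n) f = begin
  sumTo n f +ℤ f (suc n)                  ≡⟨ ℤP.+-comm (sumTo n f) (f (suc n)) ⟩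
  f (suc n) +ℤ sumTo n f                  ≡⟨ cong (f (suc n) +ℤ_) (sumTo-reverse n f) ⟩
  f (suc n) +ℤ sumTo n (λ k → f (n ∸ k))  ≡⟨ sumTo-sucˡ n (λ k → f (suc n ∸ k)) ⟨
  sumTo (suc n) (λ k → f (suc n ∸ k))     ∎

sumTo-swap : ∀ n m (a : ℕ → ℕ → ℤ) →
  sumTo n (λ i → sumTo m (a i)) ≡ sumTo m (λ k → sumTo n (λ i → a i k))
sumTo-swap zero    m a = refl
sumTo-swap (suc n) m a = trans (cong (_+ℤ sumTo m (a (suc n))) (sumTo-swap n m a))
  (sym (sumTo-+ m (λ k → sumTo n (λ i → a i k)) (a (suc n))))

sumTo-extend : ∀ {n} M (f : ℕ → ℤ) → n ≤ M → (∀ k → n < k → f k ≡ 0ℤ) → sumTo M f ≡ sumTo n f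
sumTo-extend zero    f z≤n   _ = refl
sumTo-extend (suc M) f n≤1+M f≡0 with ℕP.m≤n⇒m<n∨m≡n n≤1+M
... | inj₂ refl      = refl
... | inj₁ (s≤s n≤M) =
  trans (cong₂ _+ℤ_ (sumTo-extend M f n≤M f≡0) (f≡0 (suc M) (s≤s n≤M))) (ℤP.+-identityʳ _)

sumFin-cong : ∀ {n} {f g : Fin n → ℤ} → (∀ i → f i ≡ g i) → sumFin f ≡ sumFin g
sumFin-cong {zero}  f≗g = refl
sumFin-cong {suc n} f≗g = cong₂ _+ℤ_ (f≗g Fin.zero) (sumFin-cong (λ i → f≗g (Fin.suc i)))

sumFin-sumTo : ∀ n (f : ℕ → ℤ) → sumFin {suc n} (λ i → f (toℕ i)) ≡ sumTo n f
sumFin-sumTo zero    f = ℤP.+-identityʳ (f 0)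
sumFin-sumTo (suc n) f = trans (cong (f 0 +ℤ_) (sumFin-sumTo n (λ k → f (suc k)))) (sym (sumTo-sucˡ n f))

-- Formal power series

infixl 6 _⊕_
infix  8 ⊝_

_⊕_ : Series → Series → Series
(f ⊕ g) n = f n +ℤ g n

⊝_ : Series → Series
(⊝ f) n = - f n

𝟘 : Series
𝟘 _ = 0ℤ

shift : Series → Series
shift f zero    = 0ℤ
shift f (suc n) = f n

shiftBy : ℕ → Series → Series
shiftBy zero    f = f
shiftBy (suc i) f = shift (shiftBy i f)

shift-cong : ∀ {f g} → f ≗ g → shift f ≗ shift g
shift-cong f≗g zero    = refl
shift-cong f≗g (suc n) = f≗g n

shiftBy-≤ : ∀ i f {m} → i ≤ m → shiftBy i f m ≡ f (m ∸ i)
shiftBy-≤ zero    f _         = refl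
shiftBy-≤ (suc i) f (s≤s i≤m) = shiftBy-≤ i f i≤m

shiftBy-< : ∀ i f {m} → m < i → shiftBy i f m ≡ 0ℤ
shiftBy-< (suc i) f {zero}  _         = refl
shiftBy-< (suc i) f {suc m} (s≤s m<i) = shiftBy-< i f m<i

⊛-cong : ∀ {f f′ g g′} → f ≗ f′ → g ≗ g′ → (f ⊛ g) ≗ (f′ ⊛ g′)
⊛-cong f≗f′ g≗g′ n = sumTo-cong n (λ k → cong₂ _*ℤ_ (f≗f′ k) (g≗g′ (n ∸ k)))

⊛-congˡ : ∀ {f f′} g → f ≗ f′ → (f ⊛ g) ≗ (f′ ⊛ g)
⊛-congˡ {f} {f′} g f≗f′ = ⊛-cong {f} {f′} {g} {g} f≗f′ (λ _ → refl)

⊛-congʳ : ∀ f {g g′} → g ≗ g′ → (f ⊛ g) ≗ (f ⊛ g′)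
⊛-congʳ f {g} {g′} g≗g′ = ⊛-cong {f} {f} {g} {g′} (λ _ → refl) g≗g′

⊛-comm : ∀ f g → (f ⊛ g) ≗ (g ⊛ f)
⊛-comm f g n = trans (sumTo-reverse n _) (sumTo-cong-≤ n (λ k k≤n →
  trans (cong (λ j → f (n ∸ k) *ℤ g j) (ℕP.m∸[m∸n]≡n k≤n)) (ℤP.*-comm (f (n ∸ k)) (g k))))

⊛-distribʳ : ∀ f g h → ((f ⊕ g) ⊛ h) ≗ ((f ⊛ h) ⊕ (g ⊛ h))
⊛-distribʳ f g h n =
  trans (sumTo-cong n (λ k → ℤP.*-distribʳ-+ (h (n ∸ k)) (f k) (g k))) (sumTo-+ n _ _)

shift-⊛ : ∀ f g → (shift f ⊛ g) ≗ shift (f ⊛ g)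
shift-⊛ f g zero    = ℤP.*-zeroˡ (g 0)
shift-⊛ f g (suc n) =
  trans (sumTo-sucˡ n _) (trans (cong (_+ℤ (f ⊛ g) n) (ℤP.*-zeroˡ (g (suc n)))) (ℤP.+-identityˡ _))

shiftBy-⊛ : ∀ i f g → (shiftBy i f ⊛ g) ≗ shiftBy i (f ⊛ g)
shiftBy-⊛ zero    f g n = refl
shiftBy-⊛ (suc i) f g n = trans (shift-⊛ (shiftBy i f) g n) (shift-cong (shiftBy-⊛ i f g) n)

-- Sᵢ is divisible by xⁱ, which makes Σᵢ fᵢ Sᵢ a locally finite sum.
LocallyFinite : (ℕ → Series) → Set
LocallyFinite S = ∀ i m → m < i → S i m ≡ 0ℤ

lincomb : Series → (ℕ → Series) → Series
lincomb f S m = sumTo m (λ i → f i *ℤ S i m)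

lincomb-cong : ∀ {f f′ S T} → f ≗ f′ → (∀ i → S i ≗ T i) → lincomb f S ≗ lincomb f′ T
lincomb-cong f≗f′ S≗T m = sumTo-cong m (λ i → cong₂ _*ℤ_ (f≗f′ i) (S≗T i m))

lincomb-congʳ : ∀ f {S T} → (∀ i → S i ≗ T i) → lincomb f S ≗ lincomb f T
lincomb-congʳ f = lincomb-cong {f} {f} (λ _ → refl)

lincomb-one : ∀ S → lincomb one S ≗ S 0
lincomb-one S zero    = ℤP.*-identityˡ (S 0 0)
lincomb-one S (suc m) = begin
  lincomb one S (suc m)                                     ≡⟨ sumTo-sucˡ m _ ⟩
  + 1 *ℤ S 0 (suc m) +ℤ sumTo m (λ i → 0ℤ *ℤ S (suc i) (suc m))
                                                            ≡⟨ cong₂ _+ℤ_ (ℤP.*-identityˡ (S 0 (suc m)))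
                                                                 (sumTo-0 m _ (λ i _ → ℤP.*-zeroˡ (S (suc i) (suc m)))) ⟩
  S 0 (suc m) +ℤ 0ℤ                                         ≡⟨ ℤP.+-identityʳ (S 0 (suc m)) ⟩
  S 0 (suc m)                                               ∎

-- Local finiteness lets the inner sum run up to N, after which the two sums can be exchanged.
lincomb-sum : ∀ f S (w : ℕ → ℤ) → LocallyFinite S → ∀ N →
  sumTo N (λ m → lincomb f S m *ℤ w m) ≡ sumTo N (λ i → f i *ℤ sumTo N (λ m → S i m *ℤ w m))
lincomb-sum f S w S-lf N = begin
  sumTo N (λ m → sumTo m (λ i → a i m) *ℤ w m)  ≡⟨ sumTo-cong N (λ m → sumTo-*ʳ m (w m) (λ i → a i m)) ⟨
  sumTo N (λ m → sumTo m (λ i → a i m *ℤ w m))  ≡⟨ sumTo-cong-≤ N (λ m m≤N → sumTo-extend N _ m≤N (λ i m<i →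
                                                     trans (cong (_*ℤ w m) (a≡0 i m m<i)) (ℤP.*-zeroˡ (w m)))) ⟨
  sumTo N (λ m → sumTo N (λ i → a i m *ℤ w m))  ≡⟨ sumTo-swap N N (λ m i → a i m *ℤ w m) ⟩
  sumTo N (λ i → sumTo N (λ m → a i m *ℤ w m))  ≡⟨ sumTo-cong N (λ i → trans
                                                     (sumTo-cong N (λ m → ℤP.*-assoc (f i) (S i m) (w m)))
                                                     (sumTo-*ˡ N (f i) (λ m → S i m *ℤ w m))) ⟩
  sumTo N (λ i → f i *ℤ sumTo N (λ m → S i m *ℤ w m)) ∎
  where
  a : ℕ → ℕ → ℤ
  a i m = f i *ℤ S i m
  a≡0 : ∀ i m → m < i → a i m ≡ 0ℤ
  a≡0 i m m<i = trans (cong (f i *ℤ_) (S-lf i m m<i)) (ℤP.*-zeroʳ (f i))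

lincomb-⊛ : ∀ f S g → LocallyFinite S → (lincomb f S ⊛ g) ≗ lincomb f (λ i → S i ⊛ g)
lincomb-⊛ f S g S-lf N = lincomb-sum f S (λ m → g (N ∸ m)) S-lf N

lincomb-lincomb : ∀ f T S → LocallyFinite T → lincomb (lincomb f T) S ≗ lincomb f (λ i → lincomb (T i) S)
lincomb-lincomb f T S T-lf N = lincomb-sum f T (λ m → S m N) T-lf N

lincomb-shift : ∀ f S → LocallyFinite S → lincomb (shift f) S ≗ lincomb f (λ i → S (suc i))
lincomb-shift f S S-lf zero    =
  trans (ℤP.*-zeroˡ (S 0 0)) (sym (trans (cong (f 0 *ℤ_) (S-lf 1 0 (s≤s z≤n))) (ℤP.*-zeroʳ (f 0))))
lincomb-shift f S S-lf (suc m) = begin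
  lincomb (shift f) S (suc m)                         ≡⟨ sumTo-sucˡ m _ ⟩
  0ℤ *ℤ S 0 (suc m) +ℤ sumTo m (λ i → b i)           ≡⟨ cong (_+ℤ sumTo m b) (ℤP.*-zeroˡ (S 0 (suc m))) ⟩
  0ℤ +ℤ sumTo m b                                    ≡⟨ ℤP.+-comm 0ℤ (sumTo m b) ⟩
  sumTo m b +ℤ 0ℤ                                    ≡⟨ cong (sumTo m b +ℤ_) b[1+m]≡0 ⟨
  sumTo m b +ℤ b (suc m)                             ∎
  where
  b : ℕ → ℤ
  b i = f i *ℤ S (suc i) (suc m)
  b[1+m]≡0 : b (suc m) ≡ 0ℤ
  b[1+m]≡0 = trans (cong (f (suc m) *ℤ_) (S-lf (suc (suc m)) (suc m) ℕP.≤-refl)) (ℤP.*-zeroʳ (f (suc m)))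

shiftBy-locallyFinite : ∀ g → LocallyFinite (λ i → shiftBy i g)
shiftBy-locallyFinite g i m m<i = shiftBy-< i g m<i

⊛-as-lincomb : ∀ f g → (f ⊛ g) ≗ lincomb f (λ i → shiftBy i g)
⊛-as-lincomb f g m = sumTo-cong-≤ m (λ i i≤m → cong (f i *ℤ_) (sym (shiftBy-≤ i g i≤m)))

⊛-identityˡ : ∀ f → (one ⊛ f) ≗ f
⊛-identityˡ f m = trans (⊛-as-lincomb one f m) (lincomb-one (λ i → shiftBy i f) m)

⊛-assoc : ∀ f g h → ((f ⊛ g) ⊛ h) ≗ (f ⊛ (g ⊛ h))
⊛-assoc f g h N = begin
  ((f ⊛ g) ⊛ h) N                                   ≡⟨ ⊛-congˡ h (⊛-as-lincomb f g) N ⟩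
  (lincomb f (λ i → shiftBy i g) ⊛ h) N             ≡⟨ lincomb-⊛ f (λ i → shiftBy i g) h (shiftBy-locallyFinite g) N ⟩
  lincomb f (λ i → shiftBy i g ⊛ h) N               ≡⟨ lincomb-congʳ f (λ i → shiftBy-⊛ i g h) N ⟩
  lincomb f (λ i → shiftBy i (g ⊛ h)) N             ≡⟨ ⊛-as-lincomb f (g ⊛ h) N ⟨
  (f ⊛ (g ⊛ h)) N                                   ∎

⊛-identityʳ : ∀ f → (f ⊛ one) ≗ f
⊛-identityʳ f n = trans (⊛-comm f one n) (⊛-identityˡ f n)

X-⊛ : ∀ f → (X ⊛ f) ≗ shift f
X-⊛ f n = trans (⊛-congˡ f X≗shift-one n) (trans (shift-⊛ one f n) (shift-cong (⊛-identityˡ f) n))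
  where
  X≗shift-one : X ≗ shift one
  X≗shift-one zero          = refl
  X≗shift-one (suc zero)    = refl
  X≗shift-one (suc (suc n)) = refl

pow-locallyFinite : ∀ h → h 0 ≡ 0ℤ → LocallyFinite (pow h)
pow-locallyFinite h h₀≡0 (suc j) m (s≤s m≤j) = sumTo-0 m _ term≡0
  where
  term≡0 : ∀ k → k ≤ m → h k *ℤ pow h j (m ∸ k) ≡ 0ℤ
  term≡0 zero    _     = trans (cong (_*ℤ pow h j m) h₀≡0) (ℤP.*-zeroˡ (pow h j m))
  term≡0 (suc k) 1+k≤m = trans (cong (h (suc k) *ℤ_) (pow-locallyFinite h h₀≡0 j (m ∸ suc k)
                                  (ℕP.<-≤-trans (ℕP.∸-monoʳ-< (s≤s z≤n) 1+k≤m) m≤j)))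
                               (ℤP.*-zeroʳ (h (suc k)))

pow-+ : ∀ h i j → pow h (i + j) ≗ (pow h i ⊛ pow h j)
pow-+ h zero    j n = sym (⊛-identityˡ (pow h j) n)
pow-+ h (suc i) j n = trans (⊛-congʳ h (pow-+ h i j) n) (sym (⊛-assoc h (pow h i) (pow h j) n))

comp-cong : ∀ {f f′} h → f ≗ f′ → comp f h ≗ comp f′ h
comp-cong h f≗f′ = lincomb-cong f≗f′ (λ _ _ → refl)

comp-⊛ˡ : ∀ f h g → h 0 ≡ 0ℤ → (comp f h ⊛ g) ≗ lincomb f (λ j → pow h j ⊛ g)
comp-⊛ˡ f h g h₀≡0 = lincomb-⊛ f (pow h) g (pow-locallyFinite h h₀≡0)

comp-one : ∀ h → comp one h ≗ one
comp-one h = lincomb-one (pow h)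

comp-shift : ∀ f h → h 0 ≡ 0ℤ → comp (shift f) h ≗ (h ⊛ comp f h)
comp-shift f h h₀≡0 n = begin
  comp (shift f) h n                     ≡⟨ lincomb-shift f (pow h) (pow-locallyFinite h h₀≡0) n ⟩
  lincomb f (λ j → h ⊛ pow h j) n        ≡⟨ lincomb-congʳ f (λ j → ⊛-comm h (pow h j)) n ⟩
  lincomb f (λ j → pow h j ⊛ h) n        ≡⟨ comp-⊛ˡ f h h h₀≡0 n ⟨
  (comp f h ⊛ h) n                       ≡⟨ ⊛-comm (comp f h) h n ⟩
  (h ⊛ comp f h) n                       ∎

comp-shiftBy : ∀ i f h → h 0 ≡ 0ℤ → comp (shiftBy i f) h ≗ (pow h i ⊛ comp f h)
comp-shiftBy zero    f h h₀≡0 n = sym (⊛-identityˡ (comp f h) n)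
comp-shiftBy (suc i) f h h₀≡0 n = begin
  comp (shift (shiftBy i f)) h n         ≡⟨ comp-shift (shiftBy i f) h h₀≡0 n ⟩
  (h ⊛ comp (shiftBy i f) h) n           ≡⟨ ⊛-congʳ h (comp-shiftBy i f h h₀≡0) n ⟩
  (h ⊛ (pow h i ⊛ comp f h)) n           ≡⟨ ⊛-assoc h (pow h i) (comp f h) n ⟨
  (pow h (suc i) ⊛ comp f h) n           ∎

comp-⊛ : ∀ f g h → h 0 ≡ 0ℤ → comp (f ⊛ g) h ≗ (comp f h ⊛ comp g h)
comp-⊛ f g h h₀≡0 n = begin
  comp (f ⊛ g) h n                                    ≡⟨ comp-cong h (⊛-as-lincomb f g) n ⟩
  lincomb (lincomb f (λ i → shiftBy i g)) (pow h) n   ≡⟨ lincomb-lincomb f _ (pow h) (shiftBy-locallyFinite g) n ⟩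
  lincomb f (λ i → comp (shiftBy i g) h) n            ≡⟨ lincomb-congʳ f (λ i → comp-shiftBy i g h h₀≡0) n ⟩
  lincomb f (λ i → pow h i ⊛ comp g h) n              ≡⟨ comp-⊛ˡ f h (comp g h) h₀≡0 n ⟨
  (comp f h ⊛ comp g h) n                             ∎

⊛-distribˡ : ∀ f g h → (f ⊛ (g ⊕ h)) ≗ ((f ⊛ g) ⊕ (f ⊛ h))
⊛-distribˡ f g h n = begin
  (f ⊛ (g ⊕ h)) n              ≡⟨ ⊛-comm f (g ⊕ h) n ⟩
  ((g ⊕ h) ⊛ f) n              ≡⟨ ⊛-distribʳ g h f n ⟩
  (g ⊛ f) n +ℤ (h ⊛ f) n       ≡⟨ cong₂ _+ℤ_ (⊛-comm g f n) (⊛-comm h f n) ⟩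
  (f ⊛ g) n +ℤ (f ⊛ h) n       ∎

seriesRing : CommutativeRing _ _
seriesRing = record
  { Carrier = Series ; _≈_ = _≗_ ; _+_ = _⊕_ ; _*_ = _⊛_ ; -_ = ⊝_ ; 0# = 𝟘 ; 1# = one
  ; isCommutativeRing = record
    { isRing = record
      { +-isAbelianGroup = Pointwise.isAbelianGroup ℤP.+-0-isAbelianGroup
      ; *-cong     = ⊛-cong
      ; *-assoc    = ⊛-assoc
      ; *-identity = ⊛-identityˡ , ⊛-identityʳ
      ; distrib    = ⊛-distribˡ , λ h f g → ⊛-distribʳ f g h
      }
    ; *-comm = ⊛-comm
    }
  }

constant : ℤ → Series
constant a n = a *ℤ one n

constant-⊛ : ∀ a f → (constant a ⊛ f) ≗ (λ n → a *ℤ f n)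
constant-⊛ a f n = begin
  sumTo n (λ k → a *ℤ one k *ℤ f (n ∸ k))     ≡⟨ sumTo-cong n (λ k → ℤP.*-assoc a (one k) (f (n ∸ k))) ⟩
  sumTo n (λ k → a *ℤ (one k *ℤ f (n ∸ k)))   ≡⟨ sumTo-*ˡ n a _ ⟩
  a *ℤ (one ⊛ f) n                            ≡⟨ cong (a *ℤ_) (⊛-identityˡ f n) ⟩
  a *ℤ f n                                    ∎

constant-homomorphism : ℤ.+-*-rawRing ACR.-Raw-AlmostCommutative⟶ ACR.fromCommutativeRing seriesRing
constant-homomorphism = record
  { ⟦_⟧    = constant
  ; +-homo = λ a b n → ℤP.*-distribʳ-+ (one n) a b
  ; *-homo = λ a b n → trans (ℤP.*-assoc a b (one n)) (sym (constant-⊛ a (constant b) n))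
  ; -‿homo = λ a n → sym (ℤP.neg-distribˡ-* a (one n))
  ; 0-homo = λ n → ℤP.*-zeroˡ (one n)
  ; 1-homo = λ n → ℤP.*-identityˡ (one n)
  }

constant-≟ : ∀ a b → Maybe (constant a ≗ constant b)
constant-≟ a b with a ≟ b
... | yes refl = just (λ _ → refl)
... | no  _    = nothing

open RingSolver ℤ.+-*-rawRing (ACR.fromCommutativeRing seriesRing) constant-homomorphism constant-≟
  using (solve; _:+_; _:*_; _:-_; _:=_; con)

open CommSemigroupProperties (CommutativeRing.*-commutativeSemigroup seriesRing)
  using (interchange; x∙yz≈y∙xz; xy∙z≈y∙xz)

-- Inverses and square roots

lookup-invPrefix : ∀ a n (i : Fin (suc n)) → lookup (invPrefix a n) i ≡ inv a (n ∸ toℕ i)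
lookup-invPrefix a zero    Fin.zero    = refl
lookup-invPrefix a (suc n) Fin.zero    = refl
lookup-invPrefix a (suc n) (Fin.suc i) = lookup-invPrefix a n i

inv-suc : ∀ a n → inv a (suc n) ≡ - sumTo n (λ k → a (suc k) *ℤ inv a (n ∸ k))
inv-suc a n = cong -_ (trans (sumFin-cong (λ i → cong (a (suc (toℕ i)) *ℤ_) (lookup-invPrefix a n i)))
                             (sumFin-sumTo n (λ k → a (suc k) *ℤ inv a (n ∸ k))))

inv-inverseʳ : ∀ a → a 0 ≡ + 1 → (a ⊛ inv a) ≗ one
inv-inverseʳ a a₀≡1 zero    = cong (_*ℤ + 1) a₀≡1
inv-inverseʳ a a₀≡1 (suc n) = begin
  (a ⊛ inv a) (suc n)              ≡⟨ sumTo-sucˡ n _ ⟩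
  a 0 *ℤ inv a (suc n) +ℤ σ        ≡⟨ cong₂ (λ x y → x *ℤ y +ℤ σ) a₀≡1 (inv-suc a n) ⟩
  + 1 *ℤ (- σ) +ℤ σ                ≡⟨ cancel σ ⟩
  0ℤ                               ∎
  where
  σ : ℤ
  σ = sumTo n (λ k → a (suc k) *ℤ inv a (n ∸ k))
  cancel : ∀ x → + 1 *ℤ (- x) +ℤ x ≡ 0ℤ
  cancel = solve-∀

inv-unique : ∀ a b → a 0 ≡ + 1 → (a ⊛ b) ≗ one → inv a ≗ b
inv-unique a b a₀≡1 ab≗1 n = begin
  inv a n                   ≡⟨ ⊛-identityˡ (inv a) n ⟨
  (one ⊛ inv a) n           ≡⟨ ⊛-congˡ (inv a) ab≗1 n ⟨
  ((a ⊛ b) ⊛ inv a) n       ≡⟨ xy∙z≈y∙xz a b (inv a) n ⟩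
  (b ⊛ (a ⊛ inv a)) n       ≡⟨ ⊛-congʳ b (inv-inverseʳ a a₀≡1) n ⟩
  (b ⊛ one) n               ≡⟨ ⊛-identityʳ b n ⟩
  b n                       ∎

inv-cong : ∀ {a b} → b 0 ≡ + 1 → a ≗ b → inv a ≗ inv b
inv-cong {a} {b} b₀≡1 a≗b = inv-unique a (inv b) (trans (a≗b 0) b₀≡1)
  (λ n → trans (⊛-congˡ (inv b) a≗b n) (inv-inverseʳ b b₀≡1 n))

inv-⊛ : ∀ a b → a 0 ≡ + 1 → b 0 ≡ + 1 → inv (a ⊛ b) ≗ (inv a ⊛ inv b)
inv-⊛ a b a₀≡1 b₀≡1 = inv-unique (a ⊛ b) (inv a ⊛ inv b) (cong₂ _*ℤ_ a₀≡1 b₀≡1) λ n → begin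
  ((a ⊛ b) ⊛ (inv a ⊛ inv b)) n       ≡⟨ interchange a b (inv a) (inv b) n ⟩
  ((a ⊛ inv a) ⊛ (b ⊛ inv b)) n       ≡⟨ ⊛-cong (inv-inverseʳ a a₀≡1) (inv-inverseʳ b b₀≡1) n ⟩
  (one ⊛ one) n                       ≡⟨ ⊛-identityˡ one n ⟩
  one n                               ∎

comp-inv : ∀ g h → g 0 ≡ + 1 → h 0 ≡ 0ℤ → inv (comp g h) ≗ comp (inv g) h
comp-inv g h g₀≡1 h₀≡0 = inv-unique (comp g h) (comp (inv g) h) (cong (_*ℤ + 1) g₀≡1) λ n → begin
  (comp g h ⊛ comp (inv g) h) n       ≡⟨ comp-⊛ g (inv g) h h₀≡0 n ⟨
  comp (g ⊛ inv g) h n                ≡⟨ comp-cong h (inv-inverseʳ g g₀≡1) n ⟩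
  comp one h n                        ≡⟨ comp-one h n ⟩
  one n                               ∎

⊛-noZeroDivisors : ∀ a e → e 0 ≢ 0ℤ → (a ⊛ e) ≗ 𝟘 → a ≗ 𝟘
⊛-noZeroDivisors a e e₀≢0 ae≗0 n = vanish n n ℕP.≤-refl
  where
  instance
    e₀-nonZero : ℤ.NonZero (e 0)
    e₀-nonZero = ℤ.≢-nonZero e₀≢0
  cancel : ∀ m → a m *ℤ e 0 ≡ 0ℤ → a m ≡ 0ℤ
  cancel m eq = ℤP.*-cancelʳ-≡ (a m) 0ℤ (e 0) (trans eq (sym (ℤP.*-zeroˡ (e 0))))
  vanish : ∀ n k → k ≤ n → a k ≡ 0ℤ
  vanish zero    k z≤n    = cancel 0 (ae≗0 0)
  vanish (suc n) k k≤1+n with ℕP.m≤n⇒m<n∨m≡n k≤1+n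
  ... | inj₁ (s≤s k≤n) = vanish n k k≤n
  ... | inj₂ refl      = cancel (suc n) (begin
    a (suc n) *ℤ e 0                                                    ≡⟨ ℤP.+-identityˡ _ ⟨
    0ℤ +ℤ a (suc n) *ℤ e 0                                              ≡⟨ cong₂ (λ x i → x +ℤ a (suc n) *ℤ e i)
                                                                             (sumTo-0 n _ earlier≡0) (ℕP.n∸n≡0 n) ⟨
    sumTo n (λ j → a j *ℤ e (suc n ∸ j)) +ℤ a (suc n) *ℤ e (n ∸ n)     ≡⟨ ae≗0 (suc n) ⟩
    0ℤ                                                                  ∎)
    where
    earlier≡0 : ∀ j → j ≤ n → a j *ℤ e (suc n ∸ j) ≡ 0ℤ
    earlier≡0 j j≤n = trans (cong (_*ℤ e (suc n ∸ j)) (vanish n j j≤n)) (ℤP.*-zeroˡ (e (suc n ∸ j)))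

-- s² − t² = (s − t)(s + t), and s + t has constant term 2.
sqrt-unique : ∀ s t → s 0 ≡ + 1 → t 0 ≡ + 1 → (s ⊛ s) ≗ (t ⊛ t) → s ≗ t
sqrt-unique s t s₀≡1 t₀≡1 s²≗t² n =
  ℤP.i-j≡0⇒i≡j (s n) (t n) (⊛-noZeroDivisors (s ⊕ ⊝ t) (s ⊕ t) s₀+t₀≢0 product≗0 n)
  where
  s₀+t₀≢0 : s 0 +ℤ t 0 ≢ 0ℤ
  s₀+t₀≢0 eq with trans (sym (cong₂ _+ℤ_ s₀≡1 t₀≡1)) eq
  ... | ()
  product≗0 : ((s ⊕ ⊝ t) ⊛ (s ⊕ t)) ≗ 𝟘
  product≗0 m = begin
    ((s ⊕ ⊝ t) ⊛ (s ⊕ t)) m            ≡⟨ solve 2 (λ s t → (s :- t) :* (s :+ t) := s :* s :- t :* t)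
                                            (λ _ → refl) s t m ⟩
    (s ⊛ s) m +ℤ - (t ⊛ t) m           ≡⟨ cong (_+ℤ - (t ⊛ t) m) (s²≗t² m) ⟩
    (t ⊛ t) m +ℤ - (t ⊛ t) m           ≡⟨ ℤP.+-inverseʳ ((t ⊛ t) m) ⟩
    0ℤ                                 ∎

-- The Catalan series

lookup-catPrefix : ∀ n (i : Fin (suc n)) → lookup (catPrefix n) i ≡ catalanGF (n ∸ toℕ i)
lookup-catPrefix zero    Fin.zero    = refl
lookup-catPrefix (suc n) Fin.zero    = refl
lookup-catPrefix (suc n) (Fin.suc i) = lookup-catPrefix n i

catalanGF-suc : ∀ n → catalanGF (suc n) ≡ (catalanGF ⊛ catalanGF) n
catalanGF-suc n = begin
  sumFin (λ (i : Fin (suc n)) → lookup (catPrefix n) i *ℤ lookup (catPrefix n) (opposite i))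
    ≡⟨ sumFin-cong (λ i → cong₂ _*ℤ_ (lookup-catPrefix n i)
         (trans (lookup-catPrefix n (opposite i)) (cong (λ j → catalanGF (n ∸ j)) (opposite-prop i)))) ⟩
  sumFin (λ (i : Fin (suc n)) → term (toℕ i))
    ≡⟨ sumFin-sumTo n term ⟩
  sumTo n term
    ≡⟨ sumTo-cong-≤ n (λ k k≤n → trans (cong (λ j → catalanGF (n ∸ k) *ℤ catalanGF j) (ℕP.m∸[m∸n]≡n k≤n))
         (ℤP.*-comm (catalanGF (n ∸ k)) (catalanGF k))) ⟩
  (catalanGF ⊛ catalanGF) n
    ∎
  where
  term : ℕ → ℤ
  term k = catalanGF (n ∸ k) *ℤ catalanGF (n ∸ (n ∸ k))

xc² : Series
xc² = X ⊛ (catalanGF ⊛ catalanGF)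

catalanGF-equation : catalanGF ≗ (constant (+ 1) ⊕ xc²)
catalanGF-equation zero    = refl
catalanGF-equation (suc n) =
  trans (catalanGF-suc n) (sym (trans (ℤP.+-identityˡ (xc² (suc n))) (X-⊛ (catalanGF ⊛ catalanGF) (suc n))))

xc²-equation : xc² ≗ (X ⊛ ((constant (+ 1) ⊕ xc²) ⊛ (constant (+ 1) ⊕ xc²)))
xc²-equation = ⊛-congʳ X (⊛-cong catalanGF-equation catalanGF-equation)

sqrt[1-4x] : Series
sqrt[1-4x] = constant (+ 1) ⊕ ⊝ ((X ⊕ X) ⊛ catalanGF)

sqrt[1-4x]-square : (sqrt[1-4x] ⊛ sqrt[1-4x]) ≗ oneMinus4x
sqrt[1-4x]-square n = begin
  (sqrt[1-4x] ⊛ sqrt[1-4x]) n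
    ≡⟨ solve 2 (λ x c → (con (+ 1) :- (x :+ x) :* c) :* (con (+ 1) :- (x :+ x) :* c)
                        := (con (+ 1) :- (x :+ x :+ (x :+ x)))
                           :+ (x :+ x :+ (x :+ x)) :* (x :* (c :* c) :+ con (+ 1) :- c))
         (λ _ → refl) X catalanGF n ⟩
  (1-4x ⊕ (X ⊕ X ⊕ (X ⊕ X)) ⊛ (xc² ⊕ constant (+ 1) ⊕ ⊝ catalanGF)) n
    ≡⟨ cong (1-4x n +ℤ_) (⊛-congʳ (X ⊕ X ⊕ (X ⊕ X)) catalan≗0 n) ⟩
  1-4x n +ℤ ((X ⊕ X ⊕ (X ⊕ X)) ⊛ 𝟘) n
    ≡⟨ cong (1-4x n +ℤ_) (sumTo-0 n _ (λ k _ → ℤP.*-zeroʳ ((X ⊕ X ⊕ (X ⊕ X)) k))) ⟩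
  1-4x n +ℤ 0ℤ
    ≡⟨ ℤP.+-identityʳ (1-4x n) ⟩
  1-4x n
    ≡⟨ 1-4x≗oneMinus4x n ⟩
  oneMinus4x n
    ∎
  where
  1-4x : Series
  1-4x = constant (+ 1) ⊕ ⊝ (X ⊕ X ⊕ (X ⊕ X))
  1-4x≗oneMinus4x : 1-4x ≗ oneMinus4x
  1-4x≗oneMinus4x zero          = refl
  1-4x≗oneMinus4x (suc zero)    = refl
  1-4x≗oneMinus4x (suc (suc n)) = refl
  catalan≗0 : (xc² ⊕ constant (+ 1) ⊕ ⊝ catalanGF) ≗ 𝟘
  catalan≗0 m = begin
    xc² m +ℤ constant (+ 1) m +ℤ - catalanGF m                 ≡⟨ cong (λ c → xc² m +ℤ constant (+ 1) m +ℤ - c)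
                                                                    (catalanGF-equation m) ⟩
    xc² m +ℤ constant (+ 1) m +ℤ - (constant (+ 1) m +ℤ xc² m) ≡⟨ cancel (xc² m) (constant (+ 1) m) ⟩
    0ℤ                                                         ∎
    where
    cancel : ∀ a b → a +ℤ b +ℤ - (b +ℤ a) ≡ 0ℤ
    cancel = solve-∀

-- Binomial coefficients

pascal : ∀ N k → + (N C k) +ℤ + (N C suc k) ≡ + (suc N C suc k)
pascal N k = trans (sym (ℤP.pos-+ (N C k) (N C suc k))) (cong +_ (nCk+nC[k+1]≡[n+1]C[k+1] N k))

pascal-twice : ∀ N k →
  + (N C k) +ℤ (+ (N C suc k) +ℤ + (N C suc k)) +ℤ + (N C suc (suc k)) ≡ + (suc (suc N) C suc (suc k))
pascal-twice N k = begin
  a +ℤ (b +ℤ b) +ℤ c                                      ≡⟨ regroup a b c ⟩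
  (a +ℤ b) +ℤ (b +ℤ c)                                    ≡⟨ cong₂ _+ℤ_ (pascal N k) (pascal N (suc k)) ⟩
  + (suc N C suc k) +ℤ + (suc N C suc (suc k))            ≡⟨ pascal (suc N) (suc k) ⟩
  + (suc (suc N) C suc (suc k))                           ∎
  where
  a b c : ℤ
  a = + (N C k)
  b = + (N C suc k)
  c = + (N C suc (suc k))
  regroup : ∀ a b c → a +ℤ (b +ℤ b) +ℤ c ≡ (a +ℤ b) +ℤ (b +ℤ c)
  regroup = solve-∀

-- Unlike pascal-twice, this needs the symmetry C(2n+1, n) = C(2n+1, n+1).
pascal-central : ∀ n →
  + ((n + n) C n) +ℤ + ((n + n) C n) +ℤ (+ ((n + n) C suc n) +ℤ + ((n + n) C suc n))
    ≡ + (suc (suc (n + n)) C suc n)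
pascal-central n = begin
  a +ℤ a +ℤ (b +ℤ b)                                      ≡⟨ regroup a b ⟩
  (a +ℤ b) +ℤ (a +ℤ b)                                    ≡⟨ cong₂ _+ℤ_ (trans (pascal N n) (cong +_ symmetry)) (pascal N n) ⟩
  + (suc N C n) +ℤ + (suc N C suc n)                      ≡⟨ pascal (suc N) n ⟩
  + (suc (suc N) C suc n)                                 ∎
  where
  N : ℕ
  N = n + n
  a b : ℤ
  a = + (N C n)
  b = + (N C suc n)
  symmetry : suc N C suc n ≡ suc N C n
  symmetry = sym (trans (nCk≡nC[n∸k] (ℕP.m≤n⇒m≤1+n (ℕP.m≤m+n n n)))
                        (cong (suc N C_) (ℕP.m+n∸n≡m (suc n) n)))
  regroup : ∀ a b → a +ℤ a +ℤ (b +ℤ b) ≡ (a +ℤ b) +ℤ (a +ℤ b)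
  regroup = solve-∀

hockey-stick : ∀ N k → sumTo N (λ j → + (j C k)) ≡ + (suc N C suc k)
hockey-stick zero    k = trans (sym (ℤP.+-identityʳ (+ (0 C k)))) (pascal 0 k)
hockey-stick (suc N) k = begin
  sumTo N (λ j → + (j C k)) +ℤ + (suc N C k)    ≡⟨ cong (_+ℤ + (suc N C k)) (hockey-stick N k) ⟩
  + (suc N C suc k) +ℤ + (suc N C k)            ≡⟨ ℤP.+-comm (+ (suc N C suc k)) (+ (suc N C k)) ⟩
  + (suc N C k) +ℤ + (suc N C suc k)            ≡⟨ pascal (suc N) k ⟩
  + (suc (suc N) C suc k)                       ∎

geom-⊛ : ∀ f n → (geom ⊛ f) n ≡ sumTo n f
geom-⊛ f n = trans (⊛-comm geom f n) (sumTo-cong n (λ k → ℤP.*-identityʳ (f k)))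

geom-⊛-pow-xOver1mx : ∀ k N → (geom ⊛ pow xOver1mx k) N ≡ + (N C k)
geom-⊛-pow-xOver1mx zero    N = ⊛-identityʳ geom N
geom-⊛-pow-xOver1mx (suc k) N = begin
  (geom ⊛ (xOver1mx ⊛ pow xOver1mx k)) N          ≡⟨ x∙yz≈y∙xz geom xOver1mx (pow xOver1mx k) N ⟩
  (xOver1mx ⊛ (geom ⊛ pow xOver1mx k)) N          ≡⟨ ⊛-congˡ (geom ⊛ pow xOver1mx k) xOver1mx≗shift-geom N ⟩
  (shift geom ⊛ (geom ⊛ pow xOver1mx k)) N        ≡⟨ shift-⊛ geom (geom ⊛ pow xOver1mx k) N ⟩
  shift (geom ⊛ (geom ⊛ pow xOver1mx k)) N        ≡⟨ partialSums N ⟩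
  + (N C suc k)                                   ∎
  where
  xOver1mx≗shift-geom : xOver1mx ≗ shift geom
  xOver1mx≗shift-geom zero    = refl
  xOver1mx≗shift-geom (suc n) = refl
  partialSums : ∀ N → shift (geom ⊛ (geom ⊛ pow xOver1mx k)) N ≡ + (N C suc k)
  partialSums zero    = refl
  partialSums (suc N) = begin
    (geom ⊛ (geom ⊛ pow xOver1mx k)) N            ≡⟨ geom-⊛ (geom ⊛ pow xOver1mx k) N ⟩
    sumTo N (geom ⊛ pow xOver1mx k)               ≡⟨ sumTo-cong N (geom-⊛-pow-xOver1mx k) ⟩
    sumTo N (λ j → + (j C k))                     ≡⟨ hockey-stick N k ⟩
    + (suc N C suc k)                             ∎

riordanEntry-binomial : ∀ g → g 0 ≡ + 1 → ∀ N k →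
  riordanEntry g N k ≡ sumTo N (λ j → inv g j *ℤ + (N C (j + k)))
riordanEntry-binomial g g₀≡1 N k = begin
  (geom ⊛ (inv (comp g B) ⊛ pow B k)) N                ≡⟨ ⊛-congʳ geom (⊛-congˡ (pow B k) (comp-inv g B g₀≡1 refl)) N ⟩
  (geom ⊛ (comp (inv g) B ⊛ pow B k)) N                ≡⟨ x∙yz≈y∙xz geom (comp (inv g) B) (pow B k) N ⟩
  (comp (inv g) B ⊛ (geom ⊛ pow B k)) N                ≡⟨ comp-⊛ˡ (inv g) B (geom ⊛ pow B k) refl N ⟩
  lincomb (inv g) (λ j → pow B j ⊛ (geom ⊛ pow B k)) N ≡⟨ lincomb-congʳ (inv g) shifted-column N ⟩
  sumTo N (λ j → inv g j *ℤ + (N C (j + k)))           ∎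
  where
  B : Series
  B = xOver1mx
  shifted-column : ∀ j M → (pow B j ⊛ (geom ⊛ pow B k)) M ≡ + (M C (j + k))
  shifted-column j M = begin
    (pow B j ⊛ (geom ⊛ pow B k)) M     ≡⟨ x∙yz≈y∙xz (pow B j) geom (pow B k) M ⟩
    (geom ⊛ (pow B j ⊛ pow B k)) M     ≡⟨ ⊛-congʳ geom (pow-+ B j k) M ⟨
    (geom ⊛ pow B (j + k)) M           ≡⟨ geom-⊛-pow-xOver1mx (j + k) M ⟩
    + (M C (j + k))                    ∎

-- Columns of the Riordan array (1/√(1 − 4x), x c(x)²)

centralBinomialGF : Series
centralBinomialGF = inv sqrt[1-4x]

column : ℕ → Series
column m = pow xc² m ⊛ centralBinomialGF

-- Both recurrences come from x c² = x (1 + x c²)², and the first also from (1/√(1 − 4x)) (1 − 2x c) = 1.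
centralBinomialGF-equation :
  centralBinomialGF ≗ (constant (+ 1) ⊕ X ⊛ (centralBinomialGF ⊕ centralBinomialGF ⊕ (column 1 ⊕ column 1)))
centralBinomialGF-equation n = begin
  D n
    ≡⟨ solve 3 (λ d x w → d := d :* (con (+ 1) :- (x :+ x) :* (con (+ 1) :+ w))
                              :+ x :* (d :+ d :+ (w :* d :+ w :* d)))
         (λ _ → refl) D X xc² n ⟩
  (D ⊛ sqrt′) n +ℤ (X ⊛ (D ⊕ D ⊕ (xc² ⊛ D ⊕ xc² ⊛ D))) n
    ≡⟨ cong₂ _+ℤ_ (⊛-congʳ D sqrt′≗sqrt[1-4x] n)
                  (⊛-congʳ X (λ m → cong (λ y → D m +ℤ D m +ℤ (y +ℤ y)) (xc²⊛D≗column-1 m)) n) ⟩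
  (D ⊛ sqrt[1-4x]) n +ℤ R n
    ≡⟨ cong (_+ℤ R n) (trans (⊛-comm D sqrt[1-4x] n) (inv-inverseʳ sqrt[1-4x] refl n)) ⟩
  one n +ℤ R n
    ≡⟨ cong (_+ℤ R n) (ℤP.*-identityˡ (one n)) ⟨
  (constant (+ 1) ⊕ R) n
    ∎
  where
  D R sqrt′ : Series
  D = centralBinomialGF
  R = X ⊛ (D ⊕ D ⊕ (column 1 ⊕ column 1))
  sqrt′ = constant (+ 1) ⊕ ⊝ ((X ⊕ X) ⊛ (constant (+ 1) ⊕ xc²))
  sqrt′≗sqrt[1-4x] : sqrt′ ≗ sqrt[1-4x]
  sqrt′≗sqrt[1-4x] m =
    cong (λ y → constant (+ 1) m +ℤ - y) (⊛-congʳ (X ⊕ X) (λ k → sym (catalanGF-equation k)) m)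
  xc²⊛D≗column-1 : (xc² ⊛ D) ≗ column 1
  xc²⊛D≗column-1 = ⊛-congˡ D (λ k → sym (⊛-identityʳ xc² k))

column-equation : ∀ m →
  column (suc m) ≗ (X ⊛ (column m ⊕ (column (suc m) ⊕ column (suc m)) ⊕ column (suc (suc m))))
column-equation m n = begin
  ((xc² ⊛ pow xc² m) ⊛ D) n
    ≡⟨ ⊛-congˡ D (⊛-congˡ (pow xc² m) xc²-equation) n ⟩
  (((X ⊛ ((constant (+ 1) ⊕ xc²) ⊛ (constant (+ 1) ⊕ xc²))) ⊛ pow xc² m) ⊛ D) n
    ≡⟨ solve 4 (λ x w p d → x :* ((con (+ 1) :+ w) :* (con (+ 1) :+ w)) :* p :* d
                           := x :* (p :* d :+ (w :* p :* d :+ w :* p :* d) :+ w :* (w :* p) :* d))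
         (λ _ → refl) X xc² (pow xc² m) D n ⟩
  (X ⊛ (column m ⊕ (column (suc m) ⊕ column (suc m)) ⊕ column (suc (suc m)))) n
    ∎
  where
  D : Series
  D = centralBinomialGF

column-suc-zero : ∀ m → column (suc m) 0 ≡ 0ℤ
column-suc-zero m = trans (cong (_*ℤ centralBinomialGF 0) (pow-locallyFinite xc² refl (suc m) 0 (s≤s z≤n)))
                          (ℤP.*-zeroˡ (centralBinomialGF 0))

column-coefficient : ∀ n m → column m n ≡ + ((n + n) C (m + n))
column-coefficient zero    zero    = refl
column-coefficient zero    (suc m) = column-suc-zero m
column-coefficient (suc n) zero    = begin
  column 0 (suc n)
    ≡⟨ ⊛-identityˡ centralBinomialGF (suc n) ⟩
  centralBinomialGF (suc n)
    ≡⟨ centralBinomialGF-equation (suc n) ⟩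
  + 0 +ℤ (X ⊛ (centralBinomialGF ⊕ centralBinomialGF ⊕ (column 1 ⊕ column 1))) (suc n)
    ≡⟨ trans (ℤP.+-identityˡ _) (X-⊛ (centralBinomialGF ⊕ centralBinomialGF ⊕ (column 1 ⊕ column 1)) (suc n)) ⟩
  centralBinomialGF n +ℤ centralBinomialGF n +ℤ (column 1 n +ℤ column 1 n)
    ≡⟨ cong₂ (λ a b → a +ℤ a +ℤ (b +ℤ b))
         (trans (sym (⊛-identityˡ centralBinomialGF n)) (column-coefficient n 0)) (column-coefficient n 1) ⟩
  + ((n + n) C n) +ℤ + ((n + n) C n) +ℤ (+ ((n + n) C suc n) +ℤ + ((n + n) C suc n))
    ≡⟨ pascal-central n ⟩
  + (suc (suc (n + n)) C suc n)
    ≡⟨ cong (λ N → + (suc N C suc n)) (ℕP.+-suc n n) ⟨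
  + ((suc n + suc n) C suc n)
    ∎
column-coefficient (suc n) (suc m) = begin
  column (suc m) (suc n)
    ≡⟨ column-equation m (suc n) ⟩
  (X ⊛ (column m ⊕ (column (suc m) ⊕ column (suc m)) ⊕ column (suc (suc m)))) (suc n)
    ≡⟨ X-⊛ (column m ⊕ (column (suc m) ⊕ column (suc m)) ⊕ column (suc (suc m))) (suc n) ⟩
  column m n +ℤ (column (suc m) n +ℤ column (suc m) n) +ℤ column (suc (suc m)) n
    ≡⟨ cong₂ _+ℤ_ (cong₂ (λ a b → a +ℤ (b +ℤ b)) (column-coefficient n m) (column-coefficient n (suc m)))
                  (column-coefficient n (suc (suc m))) ⟩
  + (N C (m + n)) +ℤ (+ (N C suc (m + n)) +ℤ + (N C suc (m + n))) +ℤ + (N C suc (suc (m + n)))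
    ≡⟨ pascal-twice N (m + n) ⟩
  + (suc (suc N) C suc (suc (m + n)))
    ≡⟨ cong₂ (λ N′ k → + (suc N′ C suc k)) (ℕP.+-suc n n) (ℕP.+-suc m n) ⟨
  + ((suc n + suc n) C (suc m + suc n))
    ∎
  where
  N : ℕ
  N = n + n

inv-⊛-comp-xc²-coefficient : ∀ g → g 0 ≡ + 1 → ∀ s → s 0 ≡ + 1 → (s ⊛ s) ≗ oneMinus4x →
  ∀ n → inv (s ⊛ comp g xc²) n ≡ sumTo n (λ j → inv g j *ℤ + ((n + n) C (j + n)))
inv-⊛-comp-xc²-coefficient g g₀≡1 s s₀≡1 s²≗1-4x n = begin
  inv (s ⊛ comp g xc²) n                                ≡⟨ inv-⊛ s (comp g xc²) s₀≡1 (cong (_*ℤ + 1) g₀≡1) n ⟩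
  (inv s ⊛ inv (comp g xc²)) n                          ≡⟨ ⊛-cong (inv-cong refl s≗sqrt[1-4x]) (comp-inv g xc² g₀≡1 refl) n ⟩
  (centralBinomialGF ⊛ comp (inv g) xc²) n              ≡⟨ ⊛-comm centralBinomialGF (comp (inv g) xc²) n ⟩
  (comp (inv g) xc² ⊛ centralBinomialGF) n              ≡⟨ comp-⊛ˡ (inv g) xc² centralBinomialGF refl n ⟩
  lincomb (inv g) column n                              ≡⟨ sumTo-cong n (λ j → cong (inv g j *ℤ_) (column-coefficient n j)) ⟩
  sumTo n (λ j → inv g j *ℤ + ((n + n) C (j + n)))      ∎
  where
  s≗sqrt[1-4x] : s ≗ sqrt[1-4x]
  s≗sqrt[1-4x] = sqrt-unique s sqrt[1-4x] s₀≡1 refl (λ m → trans (s²≗1-4x m) (sym (sqrt[1-4x]-square m)))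

mainTheorem1 : (g : Series) → g 0 ≡ + 1 →
    (s : Series) → s 0 ≡ + 1 → (∀ n → (s ⊛ s) n ≡ oneMinus4x n) →
    ∀ n → centralTransform g n ≡ inv (s ⊛ comp g (X ⊛ (catalanGF ⊛ catalanGF))) n
mainTheorem1 g g₀≡1 s s₀≡1 s²≗1-4x n = begin
  centralTransform g n                                  ≡⟨ riordanEntry-binomial g g₀≡1 (n + n) n ⟩
  sumTo (n + n) (λ j → inv g j *ℤ + ((n + n) C (j + n))) ≡⟨ sumTo-extend (n + n) _ (ℕP.m≤m+n n n) vanishing ⟩
  sumTo n (λ j → inv g j *ℤ + ((n + n) C (j + n)))      ≡⟨ inv-⊛-comp-xc²-coefficient g g₀≡1 s s₀≡1 s²≗1-4x n ⟨
  inv (s ⊛ comp g xc²) n                                ∎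
  where
  vanishing : ∀ j → n < j → inv g j *ℤ + ((n + n) C (j + n)) ≡ 0ℤ
  vanishing j n<j = trans (cong (λ b → inv g j *ℤ + b) (k>n⇒nCk≡0 (ℕP.+-monoˡ-< n n<j))) (ℤP.*-zeroʳ (inv g j))
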